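{- Let $(X,R)$ be the 3-cyclic forcing network, let $P_n$ be an $X$-colored path, and let $P_n'$ be its color-contracted graph (a path obtained by contracting every edge of $P_n$ whose endpoints have the same color, each resulting vertex keeping that color). Then, with forcing with propagation, there is $i\in\{1,2,3\}$ such that the end states of both $P_n$ and $P_n'$ have all vertices colored $i$; that is, $\epsilon(\ell_0(P_n))=\epsilon(\ell_0(P_n'))$.
   Context: The 3-cyclic forcing network is $X=\{1,2,3\}$ with the ordered list of rules $R=(1\to 2,\,2\to 3,\,3\to 1)$. Applying a rule $a\to b$ in a forcing step means simultaneously recoloring with $a$ every vertex of color $b$ having a neighbor of color $a$; a propagating forcing step with rule $a\to b$ repeats forcing steps with that rule until no vertex of color $b$ has a neighbor of color $a$. The process with propagation applies propagating forcing steps with the rules in cyclic order $1\to2,2\to3,3\to1,1\to2,\dots$ until no rule can be applied; $\epsilon(\ell_0(\cdot))$ denotes the final coloring (end state) of the initial coloring $\ell_0(\cdot)$. -}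

module Defs where

open import Data.Nat using (ℕ; zero; suc)
open import Data.Bool using (Bool; true; false; _∧_; _∨_; if_then_else_)
open import Data.Maybe using (Maybe; just; nothing)
open import Data.List using (List; []; _∷_)
open import Data.List.Relation.Unary.Any using (Any)
open import Data.Product using (_×_; Σ)
open import Data.Sum using (_⊎_)
open import Data.Empty using (⊥)
open import Relation.Nullary using (¬_)
open import Relation.Binary.PropositionalEquality using (_≡_)
open import Function using (_∘_)

data Color : Set where
  c1 c2 c3 : Color

_==_ : Color → Color → Bool
c1 == c1 = true
c2 == c2 = true
c3 == c3 = true
_  == _  = false

-- A coloring of the path P_n: the list of colors of vertices v1,…,vn in order
-- (edges join consecutive vertices).
Coloring : Set
Coloring = List Color

data RuleIx : Set where
  r0 r1 r2 : RuleIx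

src tgt : RuleIx → Color
src r0 = c1
src r1 = c2
src r2 = c3
tgt r0 = c2
tgt r1 = c3
tgt r2 = c1

nextRule : RuleIx → RuleIx
nextRule r0 = r1
nextRule r1 = r2
nextRule r2 = r0

edges : Coloring → List (Color × Color)
edges [] = []
edges (x ∷ []) = []
edges (x ∷ y ∷ l) = (x Data.Product., y) ∷ edges (y ∷ l)

Applicable : Color → Color → Coloring → Set
Applicable a b l =
  Any (λ e → (Data.Product.proj₁ e ≡ a × Data.Product.proj₂ e ≡ b)
           ⊎ (Data.Product.proj₁ e ≡ b × Data.Product.proj₂ e ≡ a)) (edges l)

isA : Color → Maybe Color → Bool
isA a (just x) = x == a
isA a nothing = false

headM : Coloring → Maybe Color
headM [] = nothing
headM (x ∷ _) = just x

stepFrom : Color → Color → Maybe Color → Coloring → Coloring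
stepFrom a b prev [] = []
stepFrom a b prev (x ∷ l) =
  (if (x == b) ∧ (isA a prev ∨ isA a (headM l)) then a else x)
  ∷ stepFrom a b (just x) l

-- One forcing step with rule a → b: simultaneously recolor with a every vertex
-- of color b having a neighbor of color a (neighbors judged in the old coloring).
forcingStep : Color → Color → Coloring → Coloring
forcingStep a b = stepFrom a b nothing

iter : {A : Set} → (A → A) → ℕ → A → A
iter f zero x = x
iter f (suc k) x = f (iter f k x)

Propagate : Color → Color → Coloring → Coloring → Set
Propagate a b c d = Σ ℕ (λ k → d ≡ iter (forcingStep a b) k c × ¬ Applicable a b d)

Terminal : Coloring → Set
Terminal c = (r : RuleIx) → ¬ Applicable (src r) (tgt r) c

-- Process with propagation, currently about to use rule r, from c ends in d.
data Runs : RuleIx → Coloring → Coloring → Set where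
  done : ∀ {r c} → Terminal c → Runs r c c
  next : ∀ {r c c' d} → ¬ Terminal c → Propagate (src r) (tgt r) c c'
       → Runs (nextRule r) c' d → Runs r c d

-- d is the end state ε(ℓ₀) of the initial coloring c (process starts with 1 → 2).
EndState : Coloring → Coloring → Set
EndState c d = Runs r0 c d

-- Color contraction: contract each edge whose endpoints share a color, i.e.
-- merge maximal runs of equal consecutive colors into one vertex.
contractFrom : Color → Coloring → Coloring
contractFrom x [] = x ∷ []
contractFrom x (y ∷ l) = if x == y then contractFrom x l else x ∷ contractFrom y l

contract : Coloring → Coloring
contract [] = []
contract (x ∷ l) = contractFrom x l

-- The outcome of a propagating step with rule a → b has a closed form: a vertex of color b is
-- recolored a exactly when its maximal run of b's touches an a. This closed form commutes with
-- repeating entries, so the process runs in lockstep on a coloring and on its color contraction,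
-- the former staying a stuttering (entries repeated) of the latter. Every productive step creates
-- an edge with equal ends in the contraction, so the contraction shrinks and the process stops.
-- When no rule applies every edge is monochromatic, since any two distinct colors form a rule of
-- the cycle; hence both end states are constant, with the common first color.
module Submission where

open import Defs
open import Data.Nat using (ℕ; zero; suc; _+_; _≤_; _<_; z≤n; s≤s)
open import Data.Nat.Properties using (≤-refl; m≤n⇒m≤1+n; +-mono-≤; +-mono-≤-<; module ≤-Reasoning)
open import Data.Nat.Induction using (<-wellFounded)
open import Induction.WellFounded using (Acc; acc)
open import Data.Bool using (Bool; true; false; _∧_; _∨_; if_then_else_)
open import Data.Bool.Properties using (∨-zeroʳ; ∨-conicalˡ; ∨-conicalʳ)
open import Data.Maybe using (just; nothing)
open import Data.List using (List; []; _∷_; length)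
open import Data.List.Relation.Unary.Any using (Any; here; there)
open import Data.List.Relation.Unary.All using (All; []; _∷_)
open import Data.Vec using (Vec; toList)
open import Data.Product using (Σ; _×_; _,_; proj₁; proj₂)
open import Data.Sum using (_⊎_; inj₁; inj₂)
open import Data.Empty using (⊥-elim)
open import Function using (_∘_)
open import Relation.Nullary using (¬_)
open import Relation.Binary.PropositionalEquality using (_≡_; _≢_; refl; sym; trans; cong; cong₂; subst)

data Role : Set where
  source target bystander : Role

role : RuleIx → Color → Role
role r0 c1 = source
role r0 c2 = target
role r0 c3 = bystander
role r1 c1 = bystander
role r1 c2 = source
role r1 c3 = target
role r2 c1 = target
role r2 c2 = bystander
role r2 c3 = source

isSource isTarget : Role → Bool
isSource source = true
isSource _      = false
isTarget target = true
isTarget _      = false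

role-src : ∀ r → role r (src r) ≡ source
role-src r0 = refl
role-src r1 = refl
role-src r2 = refl

role-tgt : ∀ r → role r (tgt r) ≡ target
role-tgt r0 = refl
role-tgt r1 = refl
role-tgt r2 = refl

source⇒≡src : ∀ r {x} → role r x ≡ source → x ≡ src r
source⇒≡src r0 {c1} _ = refl
source⇒≡src r1 {c2} _ = refl
source⇒≡src r2 {c3} _ = refl
source⇒≡src r0 {c2} ()
source⇒≡src r0 {c3} ()
source⇒≡src r1 {c1} ()
source⇒≡src r1 {c3} ()
source⇒≡src r2 {c1} ()
source⇒≡src r2 {c2} ()

target⇒≡tgt : ∀ r {x} → role r x ≡ target → x ≡ tgt r
target⇒≡tgt r0 {c2} _ = refl
target⇒≡tgt r1 {c3} _ = refl
target⇒≡tgt r2 {c1} _ = refl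
target⇒≡tgt r0 {c1} ()
target⇒≡tgt r0 {c3} ()
target⇒≡tgt r1 {c1} ()
target⇒≡tgt r1 {c2} ()
target⇒≡tgt r2 {c2} ()
target⇒≡tgt r2 {c3} ()

==-src : ∀ r x → (x == src r) ≡ isSource (role r x)
==-src r0 c1 = refl
==-src r0 c2 = refl
==-src r0 c3 = refl
==-src r1 c1 = refl
==-src r1 c2 = refl
==-src r1 c3 = refl
==-src r2 c1 = refl
==-src r2 c2 = refl
==-src r2 c3 = refl

==-tgt : ∀ r x → (x == tgt r) ≡ isTarget (role r x)
==-tgt r0 c1 = refl
==-tgt r0 c2 = refl
==-tgt r0 c3 = refl
==-tgt r1 c1 = refl
==-tgt r1 c2 = refl
==-tgt r1 c3 = refl
==-tgt r2 c1 = refl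
==-tgt r2 c2 = refl
==-tgt r2 c3 = refl

isA-src : ∀ r {x ρ} → role r x ≡ ρ → isA (src r) (just x) ≡ isSource ρ
isA-src r {x} refl = ==-src r x

-- Applicability and terminal colorings

RuleEdge : RuleIx → Color → Color → Set
RuleEdge r x y = (x ≡ src r × y ≡ tgt r) ⊎ (x ≡ tgt r × y ≡ src r)

linked : Role → Role → Bool
linked source target = true
linked target source = true
linked _      _      = false

linked-irrefl : ∀ ρ → linked ρ ρ ≡ false
linked-irrefl source    = refl
linked-irrefl target    = refl
linked-irrefl bystander = refl

linked-sound : ∀ r x y → linked (role r x) (role r y) ≡ true → RuleEdge r x y
linked-sound r x y e with role r x in ρx | role r y in ρy | e
... | source | target | _ = inj₁ (source⇒≡src r ρx , target⇒≡tgt r ρy)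
... | target | source | _ = inj₂ (target⇒≡tgt r ρx , source⇒≡src r ρy)
... | source    | source    | ()
... | source    | bystander | ()
... | target    | target    | ()
... | target    | bystander | ()
... | bystander | _         | ()

linked-complete : ∀ r {x y} → RuleEdge r x y → linked (role r x) (role r y) ≡ true
linked-complete r (inj₁ (refl , refl)) rewrite role-src r | role-tgt r = refl
linked-complete r (inj₂ (refl , refl)) rewrite role-src r | role-tgt r = refl

applicable : RuleIx → Coloring → Bool
applicable r []          = false
applicable r (x ∷ [])    = false
applicable r (x ∷ y ∷ l) = linked (role r x) (role r y) ∨ applicable r (y ∷ l)

applicable-sound : ∀ r l → applicable r l ≡ true → Applicable (src r) (tgt r) l
applicable-sound r (x ∷ y ∷ l) e with linked (role r x) (role r y) in eₓᵧ | applicable-sound r (y ∷ l)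
... | true  | _     = here (linked-sound r x y eₓᵧ)
... | false | sound = there (sound e)

applicable-complete : ∀ r l → Applicable (src r) (tgt r) l → applicable r l ≡ true
applicable-complete r (x ∷ y ∷ l) (here p) rewrite linked-complete r p = refl
applicable-complete r (x ∷ y ∷ l) (there q) rewrite applicable-complete r (y ∷ l) q =
  ∨-zeroʳ (linked (role r x) (role r y))

inapplicable : ∀ r {l} → applicable r l ≡ false → ¬ Applicable (src r) (tgt r) l
inapplicable r {l} e a with trans (sym (applicable-complete r l a)) e
... | ()

applicable⇒¬Terminal : ∀ r {l} → applicable r l ≡ true → ¬ Terminal l
applicable⇒¬Terminal r {l} e t = t r (applicable-sound r l e)

inapplicable⇒Terminal : ∀ r {l} → applicable r l ≡ false → applicable (nextRule r) l ≡ false →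
                        applicable (nextRule (nextRule r)) l ≡ false → Terminal l
inapplicable⇒Terminal r0 e₀ e₁ e₂ r0 = inapplicable r0 e₀
inapplicable⇒Terminal r0 e₀ e₁ e₂ r1 = inapplicable r1 e₁
inapplicable⇒Terminal r0 e₀ e₁ e₂ r2 = inapplicable r2 e₂
inapplicable⇒Terminal r1 e₁ e₂ e₀ r0 = inapplicable r0 e₀
inapplicable⇒Terminal r1 e₁ e₂ e₀ r1 = inapplicable r1 e₁
inapplicable⇒Terminal r1 e₁ e₂ e₀ r2 = inapplicable r2 e₂
inapplicable⇒Terminal r2 e₂ e₀ e₁ r0 = inapplicable r0 e₀
inapplicable⇒Terminal r2 e₂ e₀ e₁ r1 = inapplicable r1 e₁
inapplicable⇒Terminal r2 e₂ e₀ e₁ r2 = inapplicable r2 e₂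

unlinked⇒≡ : ∀ x y → (∀ r → ¬ RuleEdge r x y) → x ≡ y
unlinked⇒≡ c1 c1 _ = refl
unlinked⇒≡ c2 c2 _ = refl
unlinked⇒≡ c3 c3 _ = refl
unlinked⇒≡ c1 c2 h = ⊥-elim (h r0 (inj₁ (refl , refl)))
unlinked⇒≡ c2 c1 h = ⊥-elim (h r0 (inj₂ (refl , refl)))
unlinked⇒≡ c2 c3 h = ⊥-elim (h r1 (inj₁ (refl , refl)))
unlinked⇒≡ c3 c2 h = ⊥-elim (h r1 (inj₂ (refl , refl)))
unlinked⇒≡ c3 c1 h = ⊥-elim (h r2 (inj₁ (refl , refl)))
unlinked⇒≡ c1 c3 h = ⊥-elim (h r2 (inj₂ (refl , refl)))

Terminal-monochromatic : ∀ {x l} → Terminal (x ∷ l) → All (_≡ x) (x ∷ l)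
Terminal-monochromatic {x} {[]}    t = refl ∷ []
Terminal-monochromatic {x} {y ∷ l} t with unlinked⇒≡ x y (λ r e → t r (here e))
... | refl = refl ∷ Terminal-monochromatic (λ r a → t r (there a))

-- Propagation in closed form

reaches : Role → Bool → Bool
reaches source    _ = true
reaches target    k = k
reaches bystander _ = false

reachesSource : RuleIx → Coloring → Bool
reachesSource r []      = false
reachesSource r (x ∷ l) = reaches (role r x) (reachesSource r l)

recolor : Color → Bool → Color → Role → Color
recolor a s x source    = x
recolor a s x target    = if s then a else x
recolor a s x bystander = x

-- The flag p tells whether a source is reachable from the left of l through target vertices.
settle : RuleIx → Bool → Coloring → Coloring
settle r p []      = []
settle r p (x ∷ l) =
  recolor (src r) (p ∨ reachesSource r l) x (role r x) ∷ settle r (reaches (role r x) p) l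

propagate : RuleIx → Coloring → Coloring
propagate r = settle r false

force : RuleIx → Coloring → Coloring
force r = forcingStep (src r) (tgt r)

forcing-head : ∀ r x s → (if (x == tgt r) ∧ s then src r else x) ≡ recolor (src r) s x (role r x)
forcing-head r x s rewrite ==-tgt r x with role r x
... | source    = refl
... | target    = refl
... | bystander = refl

isA-source : ∀ r {x} → isA (src r) (just x) ≡ true → role r x ≡ source
isA-source r {x} e with role r x | trans (sym (==-src r x)) e
... | source    | _  = refl
... | target    | ()
... | bystander | ()

isA-nonsource : ∀ r {x ρ} → role r x ≡ ρ → isSource ρ ≡ false → isA (src r) (just x) ≢ true
isA-nonsource r ρx ns e with trans (sym (trans (isA-src r ρx) ns)) e
... | ()

reachesSource-head : ∀ r l → isA (src r) (headM l) ≡ true → reachesSource r l ≡ true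
reachesSource-head r (x ∷ l) e rewrite isA-source r e = refl

reachesSource-force : ∀ r {x} → role r x ≡ target → ∀ l →
                      reachesSource r (stepFrom (src r) (tgt r) (just x) l) ≡ reachesSource r l
reachesSource-force r ρ [] = refl
reachesSource-force r {x} ρ (y ∷ l)
  rewrite isA-src r ρ | forcing-head r y (isA (src r) (headM l)) with role r y in ρy
... | source    rewrite ρy = refl
... | bystander rewrite ρy = refl
... | target with isA (src r) (headM l) in e
...   | true  rewrite role-src r | reachesSource-head r l e = refl
...   | false rewrite ρy = reachesSource-force r ρy l

-- prev and p describe the left context of l before the forcing step, q the one after it.
settle-force : ∀ r q prev p l → (isA (src r) prev ≡ true → p ≡ true) →
               q ≡ p ⊎ isA (src r) (headM l) ≡ true →
               settle r q (stepFrom (src r) (tgt r) prev l) ≡ settle r p l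
settle-force r q prev p [] _ _ = refl
settle-force r q prev p (x ∷ l) hp hq
  rewrite forcing-head r x (isA (src r) prev ∨ isA (src r) (headM l)) with role r x in ρ
... | source rewrite ρ =
  cong (x ∷_) (settle-force r true (just x) true l (λ _ → refl) (inj₁ refl))
... | bystander rewrite ρ =
  cong (x ∷_) (settle-force r false (just x) false l (⊥-elim ∘ isA-nonsource r ρ refl) (inj₁ refl))
... | target with isA (src r) prev in e₁ | isA (src r) (headM l) in e₂
...   | true | _ rewrite role-src r | hp refl =
  cong (src r ∷_) (settle-force r true (just x) true l (λ _ → refl) (inj₁ refl))
...   | false | true rewrite role-src r | reachesSource-head r l e₂ | ∨-zeroʳ p =
  cong (src r ∷_) (settle-force r true (just x) p l (⊥-elim ∘ isA-nonsource r ρ refl) (inj₂ e₂))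
...   | false | false with hq
...     | inj₁ refl rewrite ρ | reachesSource-force r ρ l =
  cong (recolor (src r) (q ∨ reachesSource r l) x target ∷_)
       (settle-force r q (just x) q l (⊥-elim ∘ isA-nonsource r ρ refl) (inj₁ refl))
...     | inj₂ e = ⊥-elim (isA-nonsource r ρ refl e)

reaches-linked : ∀ ρ σ p → (p ≡ true → isTarget ρ ≡ false) → linked ρ σ ≡ false →
                 reaches ρ p ≡ true → isTarget σ ≡ false
reaches-linked source    source    p     _  _  _  = refl
reaches-linked source    bystander p     _  _  _  = refl
reaches-linked source    target    p     _  () _
reaches-linked target    σ         true  hp _  _  with hp refl
... | ()
reaches-linked target    σ         false _  _  ()
reaches-linked bystander σ         p     _  _  ()

reachesSource-inapplicable : ∀ r {x} l → role r x ≡ target → applicable r (x ∷ l) ≡ false →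
                             reachesSource r l ≡ false
reachesSource-inapplicable r []      ρ e = refl
reachesSource-inapplicable r (y ∷ l) ρ e rewrite ρ with role r y in ρy | e
... | source    | ()
... | target    | e′ = reachesSource-inapplicable r l ρy e′
... | bystander | _  = refl

settle-head-fixed : ∀ r p x l → (p ≡ true → isTarget (role r x) ≡ false) →
                    (role r x ≡ target → reachesSource r l ≡ false) →
                    recolor (src r) (p ∨ reachesSource r l) x (role r x) ≡ x
settle-head-fixed r p     x l hp hl with role r x
... | source    = refl
... | bystander = refl
settle-head-fixed r false x l hp hl | target rewrite hl refl = refl
settle-head-fixed r true  x l hp hl | target with hp refl
... | ()

settle-fixed : ∀ r p x l → (p ≡ true → isTarget (role r x) ≡ false) →
               applicable r (x ∷ l) ≡ false → settle r p (x ∷ l) ≡ x ∷ l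
settle-fixed r p x [] hp _ = cong (_∷ []) (settle-head-fixed r p x [] hp (λ _ → refl))
settle-fixed r p x (y ∷ l) hp e =
  cong₂ _∷_ (settle-head-fixed r p x (y ∷ l) hp (λ ρ → reachesSource-inapplicable r (y ∷ l) ρ e))
            (settle-fixed r (reaches (role r x) p) y l
              (reaches-linked (role r x) (role r y) p hp (∨-conicalˡ _ _ e))
              (∨-conicalʳ _ _ e))

propagate-fixed : ∀ r c → applicable r c ≡ false → propagate r c ≡ c
propagate-fixed r []      _ = refl
propagate-fixed r (x ∷ l) e = settle-fixed r false x l (λ ()) e

weight : Role → ℕ
weight target = 1
weight _      = 0

targets : RuleIx → Coloring → ℕ
targets r []      = 0
targets r (x ∷ l) = weight (role r x) + targets r l

recolor-weight : ∀ r s x → weight (role r (recolor (src r) s x (role r x))) ≤ weight (role r x)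
recolor-weight r s x with role r x in ρ
... | source    rewrite ρ = ≤-refl
... | bystander rewrite ρ = ≤-refl
recolor-weight r true  x | target rewrite role-src r = z≤n
recolor-weight r false x | target rewrite ρ = ≤-refl

force-targets-≤ : ∀ r prev l → targets r (stepFrom (src r) (tgt r) prev l) ≤ targets r l
force-targets-≤ r prev []      = z≤n
force-targets-≤ r prev (x ∷ l) rewrite forcing-head r x (isA (src r) prev ∨ isA (src r) (headM l)) =
  +-mono-≤ (recolor-weight r _ x) (force-targets-≤ r (just x) l)

force-linked-< : ∀ r prev x y l → linked (role r x) (role r y) ≡ true →
                 targets r (stepFrom (src r) (tgt r) prev (x ∷ y ∷ l)) < targets r (x ∷ y ∷ l)
force-linked-< r prev x y l e
  rewrite forcing-head r x (isA (src r) prev ∨ isA (src r) (just y))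
        | forcing-head r y (isA (src r) (just x) ∨ isA (src r) (headM l))
  with role r x in ρx | role r y in ρy | e
... | source | target | _ rewrite isA-src r ρx | ρx | role-src r =
  s≤s (force-targets-≤ r (just y) l)
... | target | source | _ rewrite isA-src r ρy | ∨-zeroʳ (isA (src r) prev) | role-src r | ρy =
  s≤s (force-targets-≤ r (just y) l)

force-targets-< : ∀ r prev l → applicable r l ≡ true →
                  targets r (stepFrom (src r) (tgt r) prev l) < targets r l
force-targets-< r prev (x ∷ y ∷ l) e
  with linked (role r x) (role r y) in eₓᵧ | force-targets-< r (just x) (y ∷ l)
... | true  | _    = force-linked-< r prev x y l eₓᵧ
... | false | tail rewrite forcing-head r x (isA (src r) prev ∨ isA (src r) (just y)) =
  +-mono-≤-< (recolor-weight r _ x) (tail e)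

iter-suc : ∀ {A : Set} (f : A → A) k x → iter f k (f x) ≡ iter f (suc k) x
iter-suc f zero    x = refl
iter-suc f (suc k) x = cong f (iter-suc f k x)

force-stabilises : ∀ r c → Acc _<_ (targets r c) → Σ ℕ λ k → applicable r (iter (force r) k c) ≡ false
force-stabilises r c (acc rs) with applicable r c in e
... | false = 0 , e
... | true with force-stabilises r (force r c) (rs (force-targets-< r nothing c e))
...   | k , e′ = suc k , subst (λ d → applicable r d ≡ false) (iter-suc (force r) k c) e′

propagate-force : ∀ r c → propagate r (force r c) ≡ propagate r c
propagate-force r c = settle-force r false nothing false c (λ ()) (inj₁ refl)

propagate-iter : ∀ r k c → propagate r (iter (force r) k c) ≡ propagate r c
propagate-iter r zero    c = refl
propagate-iter r (suc k) c = trans (propagate-force r (iter (force r) k c)) (propagate-iter r k c)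

propagates : ∀ r c → Propagate (src r) (tgt r) c (propagate r c)
propagates r c with force-stabilises r c (<-wellFounded (targets r c))
... | k , e =
  k , sym forced≡propagated , inapplicable r (subst (λ d → applicable r d ≡ false) forced≡propagated e)
  where
  forced≡propagated : iter (force r) k c ≡ propagate r c
  forced≡propagated = trans (sym (propagate-fixed r _ e)) (propagate-iter r k c)

-- Stutterings and color contraction

data Stutter {A : Set} : List A → List A → Set where
  []     : Stutter [] []
  keep   : ∀ x {l′ l} → Stutter l′ l → Stutter (x ∷ l′) (x ∷ l)
  repeat : ∀ {x l′ l} → Stutter (x ∷ l′) l → Stutter (x ∷ x ∷ l′) l

Stutter-head : ∀ {A : Set} {x : A} {l′ l} → Stutter (x ∷ l′) l → Σ (List A) λ l₀ → l ≡ x ∷ l₀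
Stutter-head (keep x s) = _ , refl
Stutter-head (repeat s) = Stutter-head s

reaches-idem : ∀ ρ k → reaches ρ (reaches ρ k) ≡ reaches ρ k
reaches-idem source    k = refl
reaches-idem target    k = refl
reaches-idem bystander k = refl

reachesSource-Stutter : ∀ r {l′ l} → Stutter l′ l → reachesSource r l′ ≡ reachesSource r l
reachesSource-Stutter r []                  = refl
reachesSource-Stutter r (keep x s)          = cong (reaches (role r x)) (reachesSource-Stutter r s)
reachesSource-Stutter r (repeat {x} {l′} s) =
  trans (reaches-idem (role r x) (reachesSource r l′)) (reachesSource-Stutter r s)

settle-Stutter : ∀ r p {l′ l} → Stutter l′ l → Stutter (settle r p l′) (settle r p l)
settle-Stutter r p [] = []
settle-Stutter r p (keep x s) rewrite reachesSource-Stutter r s =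
  keep _ (settle-Stutter r (reaches (role r x) p) s)
settle-Stutter r p (repeat {x} s) with role r x | settle-Stutter r p s
... | source    | s′ = repeat s′
... | target    | s′ = repeat s′
... | bystander | s′ = repeat s′

applicable-Stutter-cons : ∀ r z {l′ l} → Stutter l′ l → applicable r (z ∷ l′) ≡ applicable r (z ∷ l)
applicable-Stutter-cons r z []         = refl
applicable-Stutter-cons r z (keep y s) =
  cong (linked (role r z) (role r y) ∨_) (applicable-Stutter-cons r y s)
applicable-Stutter-cons r z (repeat {y} s) rewrite linked-irrefl (role r y) = applicable-Stutter-cons r z s

applicable-Stutter : ∀ r {l′ l} → Stutter l′ l → applicable r l′ ≡ applicable r l
applicable-Stutter r []             = refl
applicable-Stutter r (keep x s)     = applicable-Stutter-cons r x s
applicable-Stutter r (repeat {x} s) rewrite linked-irrefl (role r x) = applicable-Stutter r s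

Terminal-Stutter : ∀ {l′ l} → Stutter l′ l → Terminal l′ → Terminal l
Terminal-Stutter s t r a =
  t r (applicable-sound r _ (trans (applicable-Stutter r s) (applicable-complete r _ a)))

==-refl : ∀ x → (x == x) ≡ true
==-refl c1 = refl
==-refl c2 = refl
==-refl c3 = refl

==⇒≡ : ∀ {x y} → (x == y) ≡ true → x ≡ y
==⇒≡ {c1} {c1} _ = refl
==⇒≡ {c2} {c2} _ = refl
==⇒≡ {c3} {c3} _ = refl
==⇒≡ {c1} {c2} ()
==⇒≡ {c1} {c3} ()
==⇒≡ {c2} {c1} ()
==⇒≡ {c2} {c3} ()
==⇒≡ {c3} {c1} ()
==⇒≡ {c3} {c2} ()

Stutter-contractFrom : ∀ x l → Stutter (x ∷ l) (contractFrom x l)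
Stutter-contractFrom x []      = keep x []
Stutter-contractFrom x (y ∷ l) with x == y in eq
... | true rewrite ==⇒≡ eq = repeat (Stutter-contractFrom y l)
... | false = keep x (Stutter-contractFrom y l)

Stutter-contract : ∀ l → Stutter l (contract l)
Stutter-contract []      = []
Stutter-contract (x ∷ l) = Stutter-contractFrom x l

contractFrom-repeat : ∀ z x l → contractFrom z (x ∷ x ∷ l) ≡ contractFrom z (x ∷ l)
contractFrom-repeat z x l with z == x
... | true  = refl
... | false rewrite ==-refl x = refl

contractFrom-Stutter : ∀ z {l′ l} → Stutter l′ l → contractFrom z l′ ≡ contractFrom z l
contractFrom-Stutter z [] = refl
contractFrom-Stutter z (keep x s) with z == x
... | true  = contractFrom-Stutter z s
... | false = cong (z ∷_) (contractFrom-Stutter x s)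
contractFrom-Stutter z (repeat {x} {l′} s) = trans (contractFrom-repeat z x l′) (contractFrom-Stutter z s)

contract-Stutter : ∀ {l′ l} → Stutter l′ l → contract l′ ≡ contract l
contract-Stutter []             = refl
contract-Stutter (keep x s)     = contractFrom-Stutter x s
contract-Stutter (repeat {x} s) rewrite ==-refl x = contract-Stutter s

MonochromaticEdge : Coloring → Set
MonochromaticEdge l = Any (λ e → proj₁ e ≡ proj₂ e) (edges l)

contractFrom-length : ∀ x l → length (contractFrom x l) ≤ suc (length l)
contractFrom-length x []      = ≤-refl
contractFrom-length x (y ∷ l) with x == y
... | true  = m≤n⇒m≤1+n (contractFrom-length x l)
... | false = s≤s (contractFrom-length y l)

contractFrom-shrinks : ∀ x l → MonochromaticEdge (x ∷ l) → length (contractFrom x l) < suc (length l)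
contractFrom-shrinks x (y ∷ l) (here refl) rewrite ==-refl x = s≤s (contractFrom-length x l)
contractFrom-shrinks x (y ∷ l) (there m) with x == y
... | true  = s≤s (contractFrom-length x l)
... | false = s≤s (contractFrom-shrinks y l m)

contract-shrinks : ∀ {l} → MonochromaticEdge l → length (contract l) < length l
contract-shrinks {x ∷ l} m = contractFrom-shrinks x l m

settle-length : ∀ r p l → length (settle r p l) ≡ length l
settle-length r p []      = refl
settle-length r p (x ∷ l) = cong suc (settle-length r (reaches (role r x) p) l)

settle-monochromatic : ∀ r p l → applicable r l ≡ true → MonochromaticEdge (settle r p l)
settle-monochromatic r p (x ∷ y ∷ l) e
  with linked (role r x) (role r y) in eₓᵧ | settle-monochromatic r (reaches (role r x) p) (y ∷ l)
... | false | tail = there (tail e)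
... | true  | _ with role r x in ρx | role r y in ρy | eₓᵧ
...   | source | target | _ = here (source⇒≡src r ρx)
...   | target | source | _ rewrite ∨-zeroʳ p = here (sym (source⇒≡src r ρy))

contract-propagate-< : ∀ r c → applicable r c ≡ true → length (contract (propagate r c)) < length (contract c)
contract-propagate-< r c e = begin-strict
  length (contract (propagate r c))              ≡⟨ cong length (contract-Stutter (settle-Stutter r false c≈)) ⟩
  length (contract (propagate r (contract c)))   <⟨ contract-shrinks (settle-monochromatic r false (contract c) e′) ⟩
  length (propagate r (contract c))              ≡⟨ settle-length r false (contract c) ⟩
  length (contract c)                            ∎
  where
  open ≤-Reasoning
  c≈ : Stutter c (contract c)
  c≈ = Stutter-contract c
  e′ : applicable r (contract c) ≡ true
  e′ = trans (sym (applicable-Stutter r c≈)) e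

-- The process with propagation

CommonEnd : RuleIx → Coloring → Coloring → Set
CommonEnd r c c′ = Σ Color λ i → Σ Coloring λ d → Σ Coloring λ d′ →
  Runs r c d × Runs r c′ d′ × All (_≡ i) d × All (_≡ i) d′

commonEnd-terminal : ∀ r {c c′} → Stutter c c′ → Terminal c → CommonEnd r c c′
commonEnd-terminal r [] t = c1 , [] , [] , done t , done t , [] , []
commonEnd-terminal r {x ∷ _} s t with Stutter-head s
... | l , refl = x , _ , _ , done t , done t′ , Terminal-monochromatic t , Terminal-monochromatic t′
  where
  t′ : Terminal (x ∷ l)
  t′ = Terminal-Stutter s t

idle : ∀ r {c} → applicable r c ≡ false → Propagate (src r) (tgt r) c c
idle r e = 0 , refl , inapplicable r e

commonEnd-skip : ∀ r r′ {c c′} → Stutter c c′ → applicable r c ≡ false → applicable r′ c ≡ true →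
                 CommonEnd (nextRule r) c c′ → CommonEnd r c c′
commonEnd-skip r r′ {c} {c′} s e e′ (i , d , d′ , R , R′ , A , A′) =
  i , d , d′ ,
  next (applicable⇒¬Terminal r′ e′) (idle r e) R ,
  next (applicable⇒¬Terminal r′ (transfer r′ e′)) (idle r (transfer r e)) R′ ,
  A , A′
  where
  transfer : ∀ r″ {b} → applicable r″ c ≡ b → applicable r″ c′ ≡ b
  transfer r″ = trans (sym (applicable-Stutter r″ s))

commonEnd-fire : ∀ r {c c′} → Stutter c c′ → applicable r c ≡ true →
                 CommonEnd (nextRule r) (propagate r c) (propagate r c′) → CommonEnd r c c′
commonEnd-fire r {c} {c′} s e (i , d , d′ , R , R′ , A , A′) =
  i , d , d′ ,
  next (applicable⇒¬Terminal r e) (propagates r c) R ,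
  next (applicable⇒¬Terminal r (trans (sym (applicable-Stutter r s)) e)) (propagates r c′) R′ ,
  A , A′

commonEnd : ∀ r c {c′} → Stutter c c′ → Acc _<_ (length (contract c)) → CommonEnd r c c′
commonEnd r c {c′} s (acc rs) = dispatch _ _ _ refl refl refl
  where
  continue : ∀ r′ → applicable r′ c ≡ true → CommonEnd r′ c c′
  continue r′ e = commonEnd-fire r′ s e
    (commonEnd (nextRule r′) (propagate r′ c) (settle-Stutter r′ false s) (rs (contract-propagate-< r′ c e)))

  dispatch : ∀ b₀ b₁ b₂ → applicable r c ≡ b₀ → applicable (nextRule r) c ≡ b₁ →
             applicable (nextRule (nextRule r)) c ≡ b₂ → CommonEnd r c c′
  dispatch true  _     _     e₀ _  _  = continue r e₀
  dispatch false true  _     e₀ e₁ _  = commonEnd-skip r _ s e₀ e₁ (continue (nextRule r) e₁)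
  dispatch false false true  e₀ e₁ e₂ =
    commonEnd-skip r _ s e₀ e₂ (commonEnd-skip (nextRule r) _ s e₁ e₂ (continue (nextRule (nextRule r)) e₂))
  dispatch false false false e₀ e₁ e₂ = commonEnd-terminal r s (inapplicable⇒Terminal r e₀ e₁ e₂)

theorem4p8 : (n : ℕ) (ℓ₀ : Vec Color n) →
    Σ Color (λ i → Σ Coloring (λ d → Σ Coloring (λ d' →
      EndState (toList ℓ₀) d × EndState (contract (toList ℓ₀)) d'
      × All (_≡ i) d × All (_≡ i) d')))
theorem4p8 n ℓ₀ = commonEnd r0 (toList ℓ₀) (Stutter-contract (toList ℓ₀)) (<-wellFounded _)
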